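{- Let $G$ be a graph with maximum degree $\Delta\ge 6$ and clique number $\omega=\Delta-1$, such that the cliques of size $\omega$ are pairwise vertex-disjoint and no vertex outside an $\omega$-clique $C$ has more than one neighbour in $C$. Let $V_\omega$ be the set of vertices lying in some $\omega$-clique, and for $k\le\omega$ let $V_k$ be the set of vertices lying in a clique of size $k$ but in no clique of size $k+1$. If $4\le k\le\omega-1$ and $v\in V_k$, then $v$ has at most $\Delta+1-k$ neighbours in $V_\omega$. -}

module Defs where

open import Data.Nat using (ℕ; suc; _≤_)
open import Data.Fin using (Fin)
open import Data.Fin.Subset using (Subset; _∈_; _∉_; ∣_∣)
open import Data.Product using (Σ; ∃; _×_)
open import Relation.Nullary using (¬_; Dec)
open import Relation.Binary.PropositionalEquality using (_≡_; _≢_)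

record Graph : Set₁ where
  field
    n      : ℕ
    Adj    : Fin n → Fin n → Set
    adj?   : ∀ u v → Dec (Adj u v)
    sym    : ∀ {u v} → Adj u v → Adj v u
    irrefl : ∀ {u} → ¬ Adj u u

module _ (G : Graph) where
  open Graph G

  AtMost : (Fin n → Set) → ℕ → Set
  AtMost P d = ∀ (S : Subset n) → (∀ u → u ∈ S → P u) → ∣ S ∣ ≤ d

  IsClique : Subset n → Set
  IsClique S = ∀ u v → u ∈ S → v ∈ S → u ≢ v → Adj u v

  IsKClique : ℕ → Subset n → Set
  IsKClique k S = IsClique S × ∣ S ∣ ≡ k

  InKClique : ℕ → Fin n → Set
  InKClique k v = ∃ λ S → IsKClique k S × v ∈ S

  MaxDegree : ℕ → Set
  MaxDegree Δ = (∀ v → AtMost (Adj v) Δ)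
              × (∃ λ v → ∃ λ S → (∀ u → u ∈ S → Adj v u) × ∣ S ∣ ≡ Δ)

  CliqueNumber : ℕ → Set
  CliqueNumber ω = (∃ λ S → IsKClique ω S) × (∀ S → IsClique S → ∣ S ∣ ≤ ω)

  KCliquesDisjoint : ℕ → Set
  KCliquesDisjoint ω = ∀ C D → IsKClique ω C → IsKClique ω D → C ≢ D →
                       ∀ v → v ∈ C → v ∈ D → Data.Empty.⊥
    where import Data.Empty

  OneNeighbourOutside : ℕ → Set
  OneNeighbourOutside ω = ∀ C → IsKClique ω C → ∀ v → v ∉ C →
                          ∀ x y → x ∈ C → y ∈ C → Adj v x → Adj v y → x ≡ y

  Vω : ℕ → Fin n → Set
  Vω ω v = InKClique ω v

  V : ℕ → Fin n → Set
  V k v = InKClique k v × ¬ InKClique (suc k) v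

-- A neighbour u ≠ v of v inside a k-clique K cannot lie in an ω-clique C.
-- If v ∈ C, then v would lie in a (k+1)-clique inside C. If v ∉ C, then
-- C − u and K − u are disjoint (a common vertex x would give v two
-- neighbours u, x in C), so deg u ≥ (ω − 1) + (k − 1) = Δ + k − 3 > Δ.
-- Hence the neighbours of v in V_ω and the k − 1 vertices of K − v are
-- disjoint parts of the neighbourhood of v, which has at most Δ vertices.
module Submission where

open import Defs
open import Data.Nat using (ℕ; zero; suc; _+_; _∸_; _≤_; _<_; _≰_; s≤s; z≤n)
open import Data.Nat.Properties
  using (+-suc; +-comm; +-cancelˡ-≤; m+n≤o⇒m≤o∸n; m∸n+n≡m; m≤n+m; ≤-trans; ≤-reflexive; <⇒≱; >⇒≢; suc-injective; module ≤-Reasoning)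
open import Data.Fin using (Fin; zero; suc)
open import Data.Fin.Subset
open import Data.Fin.Subset.Properties
  using (drop-there; p─⊥≡p; p─q⊆p; ⊆-refl; ⊆-trans; x∈p∧x≢y⇒x∈p-y; x∉⁅y⁆⇒x≢y; x∈p∪q⁻; nonempty?; Empty-unique; ∣⊥∣≡0; _∈?_)
open import Data.Vec using ([]; _∷_; here; there)
open import Data.Product using (_×_; _,_; ∃; proj₁; proj₂)
open import Data.Sum using (inj₁; inj₂)
open import Function using (_∘_)
open import Relation.Binary.PropositionalEquality using (_≡_; _≢_; refl; sym; trans; cong; cong₂; subst; ≢-sym)
open import Relation.Nullary using (¬_; yes; no; contradiction)

x∈p─q⇒x∉q : ∀ {n} (p q : Subset n) {x} → x ∈ p ─ q → x ∉ q
x∈p─q⇒x∉q (inside ∷ p)  (outside ∷ q) here = λ ()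
x∈p─q⇒x∉q (outside ∷ p) (outside ∷ q) {zero} ()
x∈p─q⇒x∉q (s ∷ p)       (inside ∷ q)  {zero} ()
x∈p─q⇒x∉q (s ∷ p)       (t ∷ q)       (there x∈p─q) = x∈p─q⇒x∉q p q x∈p─q ∘ drop-there

x∈p-y⇒x≢y : ∀ {n} {p : Subset n} {x y} → x ∈ p - y → x ≢ y
x∈p-y⇒x≢y {p = p} {y = y} = x∉⁅y⁆⇒x≢y ∘ x∈p─q⇒x∉q p ⁅ y ⁆

x∈p⇒suc∣p-x∣≡∣p∣ : ∀ {n} {p : Subset n} {x} → x ∈ p → suc ∣ p - x ∣ ≡ ∣ p ∣
x∈p⇒suc∣p-x∣≡∣p∣ {p = inside ∷ p}  here        = cong (suc ∘ ∣_∣) (p─⊥≡p p)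
x∈p⇒suc∣p-x∣≡∣p∣ {p = inside ∷ p}  (there x∈p) = cong suc (x∈p⇒suc∣p-x∣≡∣p∣ x∈p)
x∈p⇒suc∣p-x∣≡∣p∣ {p = outside ∷ p} (there x∈p) = x∈p⇒suc∣p-x∣≡∣p∣ x∈p

∣p∪q∣≡∣p∣+∣q∣ : ∀ {n} (p q : Subset n) → (∀ {x} → x ∈ p → x ∉ q) → ∣ p ∪ q ∣ ≡ ∣ p ∣ + ∣ q ∣
∣p∪q∣≡∣p∣+∣q∣ []            []            _        = refl
∣p∪q∣≡∣p∣+∣q∣ (inside ∷ p)  (inside ∷ q)  disjoint = contradiction here (disjoint here)
∣p∪q∣≡∣p∣+∣q∣ (inside ∷ p)  (outside ∷ q) disjoint =
  cong suc (∣p∪q∣≡∣p∣+∣q∣ p q λ x∈p x∈q → disjoint (there x∈p) (there x∈q))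
∣p∪q∣≡∣p∣+∣q∣ (outside ∷ p) (inside ∷ q)  disjoint =
  trans (cong suc (∣p∪q∣≡∣p∣+∣q∣ p q λ x∈p x∈q → disjoint (there x∈p) (there x∈q)))
        (sym (+-suc ∣ p ∣ ∣ q ∣))
∣p∪q∣≡∣p∣+∣q∣ (outside ∷ p) (outside ∷ q) disjoint =
  ∣p∪q∣≡∣p∣+∣q∣ p q λ x∈p x∈q → disjoint (there x∈p) (there x∈q)

0<∣p∣⇒Nonempty : ∀ {n} {p : Subset n} → 0 < ∣ p ∣ → Nonempty p
0<∣p∣⇒Nonempty {n} {p} 0<∣p∣ with nonempty? p
... | yes nonempty = nonempty
... | no  empty    = contradiction (trans (cong ∣_∣ (Empty-unique empty)) (∣⊥∣≡0 n)) (>⇒≢ 0<∣p∣)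

∃⊆-∋-ofSize : ∀ {n} {p : Subset n} {x} m → x ∈ p → suc m ≤ ∣ p ∣ →
              ∃ λ q → q ⊆ p × x ∈ q × ∣ q ∣ ≡ suc m
∃⊆-∋-ofSize {p = p} m x∈p m<∣p∣ = shrink (∣ p ∣ ∸ suc m) x∈p (sym (m∸n+n≡m m<∣p∣))
  where
  shrink : ∀ {p x} d → x ∈ p → ∣ p ∣ ≡ d + suc m → ∃ λ q → q ⊆ p × x ∈ q × ∣ q ∣ ≡ suc m
  shrink {p} zero    x∈p ∣p∣≡1+m = p , ⊆-refl , x∈p , ∣p∣≡1+m
  shrink {p} {x} (suc d) x∈p ∣p∣≡2+d+m
    with 0<∣p∣⇒Nonempty {p = p - x}
           (subst (0 <_) (sym (suc-injective (trans (x∈p⇒suc∣p-x∣≡∣p∣ x∈p) ∣p∣≡2+d+m)))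
                  (≤-trans (s≤s z≤n) (m≤n+m (suc m) d)))
  ... | y , y∈p-x =
    let y∈p = p─q⊆p p ⁅ x ⁆ y∈p-x
        (q , q⊆p-y , x∈q , ∣q∣≡1+m) =
          shrink d (x∈p∧x≢y⇒x∈p-y x∈p (≢-sym (x∈p-y⇒x≢y y∈p-x)))
                 (suc-injective (trans (x∈p⇒suc∣p-x∣≡∣p∣ y∈p) ∣p∣≡2+d+m))
    in q , ⊆-trans q⊆p-y (p─q⊆p p ⁅ y ⁆) , x∈q , ∣q∣≡1+m

ω+k≰2+Δ : ∀ {Δ ω k} → 0 < Δ → ω ≡ Δ ∸ 1 → 4 ≤ k → ω + k ≰ 2 + Δ
ω+k≰2+Δ {suc Δ} _ refl 4≤k ω+k≤2+Δ =
  <⇒≱ 4≤k (+-cancelˡ-≤ Δ _ _ (≤-trans ω+k≤2+Δ (≤-reflexive (+-comm 3 Δ))))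

m+n≤o⇒m≤o+1∸[1+n] : ∀ m {n o} → m + n ≤ o → m ≤ o + 1 ∸ suc n
m+n≤o⇒m≤o+1∸[1+n] m {o = o} m+n≤o rewrite +-comm o 1 = m+n≤o⇒m≤o∸n m m+n≤o

module _ (G : Graph) where
  open Graph G using (n; Adj)

  IsClique-⊆ : ∀ {p q : Subset n} → p ⊆ q → IsClique G q → IsClique G p
  IsClique-⊆ p⊆q q-clique u w u∈p w∈p = q-clique u w (p⊆q u∈p) (p⊆q w∈p)

  IsClique⇒InKClique : ∀ {C v} m → IsClique G C → v ∈ C → suc m ≤ ∣ C ∣ → InKClique G (suc m) v
  IsClique⇒InKClique m C-clique v∈C m<∣C∣ =
    let (q , q⊆C , v∈q , ∣q∣≡1+m) = ∃⊆-∋-ofSize m v∈C m<∣C∣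
    in q , (IsClique-⊆ q⊆C C-clique , ∣q∣≡1+m) , v∈q

  IsClique⇒Adj : ∀ {C u x} → IsClique G C → u ∈ C → x ∈ C - u → Adj u x
  IsClique⇒Adj {C} C-clique u∈C x∈C-u =
    C-clique _ _ u∈C (p─q⊆p C _ x∈C-u) (≢-sym (x∈p-y⇒x≢y x∈C-u))

  AtMost-∪ : ∀ {P d} (p q : Subset n) → AtMost G P d →
             (∀ x → x ∈ p → P x) → (∀ x → x ∈ q → P x) → (∀ {x} → x ∈ p → x ∉ q) →
             ∣ p ∣ + ∣ q ∣ ≤ d
  AtMost-∪ {P} p q atMost p⊆P q⊆P disjoint =
    subst (_≤ _) (∣p∪q∣≡∣p∣+∣q∣ p q disjoint) (atMost (p ∪ q) ∪⊆P)
    where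
    ∪⊆P : ∀ x → x ∈ p ∪ q → P x
    ∪⊆P x x∈p∪q with x∈p∪q⁻ p q x∈p∪q
    ... | inj₁ x∈p = p⊆P x x∈p
    ... | inj₂ x∈q = q⊆P x x∈q

  module _ {ω C K u v} (oneNeighbour : OneNeighbourOutside G ω) (C-ω-clique : IsKClique G ω C)
           (K-clique : IsClique G K) (u∈C : u ∈ C) (u∈K : u ∈ K) (v∈K : v ∈ K)
           (v∉C : v ∉ C) (u≢v : u ≢ v) where

    clique-neighbourhoods-disjoint : ∀ {x} → x ∈ C - u → x ∉ K - u
    clique-neighbourhoods-disjoint {x} x∈C-u x∈K-u =
      x∈p-y⇒x≢y x∈C-u (sym (oneNeighbour C C-ω-clique v v∉C u x u∈C x∈C
                              (v-adj u∈K u≢v) (v-adj (p─q⊆p K _ x∈K-u) x≢v)))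
      where
      v-adj : ∀ {y} → y ∈ K → y ≢ v → Adj v y
      v-adj y∈K y≢v = K-clique _ _ v∈K y∈K (≢-sym y≢v)
      x∈C : x ∈ C
      x∈C = p─q⊆p C _ x∈C-u
      x≢v : x ≢ v
      x≢v refl = v∉C x∈C

    ω+∣K∣≤2+Δ : ∀ {Δ} → AtMost G (Adj u) Δ → ω + ∣ K ∣ ≤ 2 + Δ
    ω+∣K∣≤2+Δ {Δ} deg-u = begin
      ω + ∣ K ∣                          ≡⟨ cong₂ _+_ (sym 1+∣C-u∣≡ω) (sym (x∈p⇒suc∣p-x∣≡∣p∣ u∈K)) ⟩
      suc ∣ C - u ∣ + suc ∣ K - u ∣      ≡⟨ cong suc (+-suc ∣ C - u ∣ ∣ K - u ∣) ⟩
      2 + (∣ C - u ∣ + ∣ K - u ∣)        ≤⟨ s≤s (s≤s (AtMost-∪ (C - u) (K - u) deg-u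
                                               (λ _ → IsClique⇒Adj (proj₁ C-ω-clique) u∈C)
                                               (λ _ → IsClique⇒Adj K-clique u∈K)
                                               clique-neighbourhoods-disjoint)) ⟩
      2 + Δ                              ∎
      where
      open ≤-Reasoning
      1+∣C-u∣≡ω : suc ∣ C - u ∣ ≡ ω
      1+∣C-u∣≡ω = trans (x∈p⇒suc∣p-x∣≡∣p∣ u∈C) (proj₂ C-ω-clique)

lemma5 : (G : Graph) (Δ ω : ℕ) →
         6 ≤ Δ → MaxDegree G Δ →
         ω ≡ Δ ∸ 1 → CliqueNumber G ω →
         KCliquesDisjoint G ω → OneNeighbourOutside G ω →
         (k : ℕ) → 4 ≤ k → suc k ≤ ω →
         (v : Fin (Graph.n G)) → V G k v →
         AtMost G (λ u → Graph.Adj G v u × Vω G ω u) (Δ + 1 ∸ k)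
lemma5 G Δ ω 6≤Δ (deg , _) ω≡Δ∸1 _ _ oneNeighbour k 4≤k k<ω v
       ((K , (K-clique , ∣K∣≡k) , v∈K) , v∉Vₖ₊₁) S S⊆N[v]∩Vω =
  subst (λ c → ∣ S ∣ ≤ Δ + 1 ∸ c) (trans (x∈p⇒suc∣p-x∣≡∣p∣ v∈K) ∣K∣≡k)
    (m+n≤o⇒m≤o+1∸[1+n] ∣ S ∣
      (AtMost-∪ G S (K - v) (deg v) (λ x → proj₁ ∘ S⊆N[v]∩Vω x)
        (λ _ → IsClique⇒Adj G K-clique v∈K)
        (λ {x} x∈S x∈K-v → K-v∌Vω (p─q⊆p K _ x∈K-v) (x∈p-y⇒x≢y x∈K-v) (proj₂ (S⊆N[v]∩Vω x x∈S)))))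
  where
  K-v∌Vω : ∀ {u} → u ∈ K → u ≢ v → ¬ Vω G ω u
  K-v∌Vω {u} u∈K u≢v (C , C-ω-clique , u∈C) with v ∈? C
  ... | yes v∈C = v∉Vₖ₊₁ (IsClique⇒InKClique G k (proj₁ C-ω-clique) v∈C
                                               (subst (suc k ≤_) (sym (proj₂ C-ω-clique)) k<ω))
  ... | no  v∉C = ω+k≰2+Δ (≤-trans (s≤s z≤n) 6≤Δ) ω≡Δ∸1 4≤k
                    (subst (λ c → ω + c ≤ 2 + Δ) ∣K∣≡k
                      (ω+∣K∣≤2+Δ G oneNeighbour C-ω-clique K-clique u∈C u∈K v∈K v∉C u≢v (deg u)))
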